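{- If a graph $G$ has an $(a,b)$-DR-splittable cycle decomposition into cycles of length $\ell$, then $G\,\square\,G$ has an $(a|V(G)|,\,b|V(G)|)$-DR-splittable decomposition into cycles of length $\ell$.
   Context: Cartesian product $G\,\square\,H$: vertex set $V(G)\times V(H)$, $(u,v)(u',v')$ an edge iff ($u=u'$, $vv'\in E(H)$) or ($v=v'$, $uu'\in E(G)$). A decomposition of $G$ is a set of pairwise edge-disjoint subgraphs whose union is $G$. A set of graphs $\{G_1,\dots,G_a\}$ is a splittable decomposition of a graph $H$ if it is a decomposition of $H$ and there are pairwise disjoint sets $S_i\subseteq V(G_i)$ (representing sets) with $|S_1|=\dots=|S_a|\ge2$ and $\bigcup_i S_i=V(H)$. For $a,m\ge1$, a decomposition $\{G_1,\dots,G_{am}\}$ of $G$ is $a$-splittable if it can be partitioned into $m$ sets $\mathcal F_1,\dots,\mathcal F_m$ of $a$ graphs each, each $\mathcal F_i$ forming a splittable decomposition of a spanning subgraph of $G$. It is $(a,b)$-splittable if moreover each $\mathcal F_i$ can be partitioned into $a/b$ subsets each consisting of $b$ graphs that are pairwise vertex-disjoint and whose vertex sets together cover $V(G)$. Such a cycle decomposition is $(a,b)$-DR-splittable if additionally for every cycle $C$ with representing set $S$, traversing $C$ in a fixed direction, all paths between consecutive elements of $S$ have the same length. The length of a cycle is its number of edges. -}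

module Defs where

open import Data.Nat using (ℕ; zero; suc; _+_; _*_; _∸_; _≤_; _<_)
open import Data.Nat.DivMod using (_%_; m%n<n)
open import Data.Fin using (Fin; toℕ; fromℕ<)
open import Data.Fin.Subset using (Subset; _∈_; ∣_∣)
open import Data.Product using (Σ; ∃; _×_; _,_)
open import Data.Sum using (_⊎_; inj₁; inj₂)
open import Relation.Binary.PropositionalEquality using (_≡_; _≢_; refl)
open import Relation.Nullary using (¬_)

record Graph (V : Set) : Set₁ where
  field
    Adj    : V → V → Set
    adj-sym : ∀ {u v} → Adj u v → Adj v u
    irrefl : ∀ {u} → ¬ Adj u u
open Graph public

_□_ : ∀ {V W} → Graph V → Graph W → Graph (V × W)
Adj (G □ H) (u , v) (u' , v') = (u ≡ u' × Adj H v v') ⊎ (v ≡ v' × Adj G u u')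
adj-sym (G □ H) (inj₁ (refl , e)) = inj₁ (refl , adj-sym H e)
adj-sym (G □ H) (inj₂ (refl , e)) = inj₂ (refl , adj-sym G e)
irrefl (G □ H) (inj₁ (_ , e)) = irrefl H e
irrefl (G □ H) (inj₂ (_ , e)) = irrefl G e

nxt : ∀ {ℓ} → Fin ℓ → Fin ℓ
nxt {suc k} i = fromℕ< (m%n<n (suc (toℕ i)) (suc k))

dist : ∀ {ℓ} → Fin ℓ → Fin ℓ → ℕ
dist {suc k} p q = (toℕ q + suc k ∸ toℕ p) % suc k

record Cycle {V : Set} (G : Graph V) (ℓ : ℕ) : Set where
  field
    vert : Fin ℓ → V
    len≥3 : 3 ≤ ℓ
    inj  : ∀ p q → vert p ≡ vert q → p ≡ q
    adj  : ∀ p → Adj G (vert p) (vert (nxt p))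
open Cycle public

HasEdge : ∀ {V} {G : Graph V} {ℓ} → Cycle G ℓ → V → V → Set
HasEdge C u v = ∃ λ p → (vert C p ≡ u × vert C (nxt p) ≡ v) ⊎ (vert C p ≡ v × vert C (nxt p) ≡ u)

OnCycle : ∀ {V} {G : Graph V} {ℓ} → Cycle G ℓ → V → Set
OnCycle C v = ∃ λ p → vert C p ≡ v

-- A family of cycles (indexed by I) is a decomposition of G: every edge of G
-- lies in exactly one cycle of the family (cycle edges are edges of G by definition).
IsDecomposition : ∀ {V} (G : Graph V) {ℓ} {I : Set} → (I → Cycle G ℓ) → Set
IsDecomposition G {I = I} C =
  (∀ u v → Adj G u v → ∃ λ j → HasEdge (C j) u v) ×
  (∀ u v j j' → HasEdge (C j) u v → HasEdge (C j') u v → j ≡ j')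

-- Representing set S (given as a set of positions of C) is DR: traversing C in its
-- fixed direction, all paths between consecutive elements of S have the same length.
-- q is the element of S next after p iff q ≠ p (positive distance) and no element
-- of S lies strictly closer ahead of p.
NextInS : ∀ {ℓ} → Subset ℓ → Fin ℓ → Fin ℓ → Set
NextInS S p q = p ∈ S × q ∈ S × 0 < dist p q ×
  (∀ r → r ∈ S → 0 < dist p r → dist p q ≤ dist p r)

IsDR : ∀ {ℓ} → Subset ℓ → Set
IsDR S = ∀ p q p' q' → NextInS S p q → NextInS S p' q' → dist p q ≡ dist p' q'

-- The decomposition {G_1,…,G_{am}} is indexed by (i , s , t) ∈ Fin m × Fin k × Fin b
-- with a = k * b: F_i = { C i s t }, and for each (i , s) the b graphs C i s t form
-- one of the a/b subsets.  S i s t is the representing set (as positions of C i s t).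
record DRSplittable {V : Set} (G : Graph V) (ℓ a b : ℕ) : Set₁ where
  field
    m k   : ℕ
    a≥1   : 1 ≤ a
    m≥1   : 1 ≤ m
    a≡kb  : a ≡ k * b
    C     : Fin m → Fin k → Fin b → Cycle G ℓ
    S     : Fin m → Fin k → Fin b → Subset ℓ
    decomp : IsDecomposition G {I = Fin m × Fin k × Fin b} (λ { (i , s , t) → C i s t })
    -- each F_i is a splittable decomposition of a spanning subgraph
    sizeEq : ∀ i s t s' t' → ∣ S i s t ∣ ≡ ∣ S i s' t' ∣
    size≥2 : ∀ i s t → 2 ≤ ∣ S i s t ∣
    repDisj : ∀ i s t s' t' → (s , t) ≢ (s' , t') → ∀ p p' →
              p ∈ S i s t → p' ∈ S i s' t' → vert (C i s t) p ≢ vert (C i s' t') p'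
    repCover : ∀ i v → ∃ λ s → ∃ λ t → ∃ λ p → p ∈ S i s t × vert (C i s t) p ≡ v
    blockDisj : ∀ i s t t' → t ≢ t' → ∀ p p' → vert (C i s t) p ≢ vert (C i s t') p'
    blockCover : ∀ i s v → ∃ λ t → OnCycle (C i s t) v
    dr : ∀ i s t → IsDR (S i s t)

-- G □ G is the edge-disjoint union of its "horizontal" copies G × {w}
-- and its "vertical" copies {w} × G, one of each kind for every vertex w.
-- Copying every cycle of the given decomposition into every copy of G gives
-- a decomposition of G □ G into cycles of the same length.  The classes F_i
-- are doubled (one per direction), and within a class the block of b graphs
-- indexed by t becomes a block of b·n graphs indexed by pairs (t , w): the
-- copies of a vertex-disjoint, vertex-covering block along all n levels w are
-- again vertex-disjoint and cover V(G) × V(G).  Representing sets and hence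
-- the DR property are inherited unchanged, since copying preserves positions.

module Submission where

open import Defs
open import Data.Nat using (ℕ; _*_; _+_; _≤_; s≤s; z≤n; >-nonZero; >-nonZero⁻¹)
open import Data.Nat.Properties using (*-assoc; *-mono-≤; ≤-trans; ≤-<-trans; m≤m+n; m*n≢0⇒m≢0; m*n≢0⇒n≢0)
open import Data.Fin using (Fin; fromℕ<)
open import Data.Fin.Properties using (toℕ<n; +↔⊎; *↔×)
open import Data.Fin.Subset using (Subset; _∈_)
open import Data.Product using (∃; _×_; _,_; proj₁; proj₂)
open import Data.Sum using (_⊎_; inj₁; inj₂)
open import Data.Empty using (⊥-elim)
open import Function using (_∘_; _↔_; Inverse; mk↔ₛ′; Injection)
open import Function.Properties.Inverse using (↔-refl; ↔-trans; ↔-sym; ↔⇒↣)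
open import Data.Product.Function.NonDependent.Propositional using (_×-↔_)
open import Relation.Nullary using (¬_)
open import Relation.Binary.PropositionalEquality
  using (_≡_; _≢_; refl; sym; trans; cong; cong₂; subst; subst₂)

private
  variable
    V I J A B : Set
    ℓ : ℕ

to-injective : (e : A ↔ B) {x y : A} → Inverse.to e x ≡ Inverse.to e y → x ≡ y
to-injective e = Injection.injective (↔⇒↣ e)

witness-along : (e : A ↔ B) {P : B → Set} → ∃ P → ∃ (P ∘ Inverse.to e)
witness-along e {P} (y , py) =
  Inverse.from e y , subst P (sym (Inverse.strictlyInverseˡ e y)) py

cycle-edge-adj : {G : Graph V} (c : Cycle G ℓ) {u v : V} → HasEdge c u v → Adj G u v
cycle-edge-adj c (p , inj₁ (refl , refl)) = adj c p
cycle-edge-adj {G = G} c (p , inj₂ (refl , refl)) = adj-sym G (adj c p)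

no-loop : {G : Graph V} (c : Cycle G ℓ) {x : V} → ¬ HasEdge c x x
no-loop {G = G} c h = irrefl G (cycle-edge-adj c h)

reindex : {G : Graph V} {C : I → Cycle G ℓ} (e : J ↔ I) →
          IsDecomposition G C → IsDecomposition G (C ∘ Inverse.to e)
reindex {G = G} {C = C} e (cover , unique) = cover′ , unique′
  where
  cover′ : ∀ u v → Adj G u v → ∃ λ j → HasEdge (C (Inverse.to e j)) u v
  cover′ u v uv = witness-along e {λ i → HasEdge (C i) u v} (cover u v uv)
  unique′ : ∀ u v j j′ → HasEdge (C (Inverse.to e j)) u v →
            HasEdge (C (Inverse.to e j′)) u v → j ≡ j′
  unique′ u v j j′ h h′ = to-injective e (unique u v _ _ h h′)

-- (1) Copies of G inside G □ G.  A direction σ says which coordinate runs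
-- along the copy; the other coordinate is the level w of the copy.

data Direction : Set where
  horizontal vertical : Direction

embed : Direction → V → V → V × V
embed horizontal x w = x , w
embed vertical   x w = w , x

along across : Direction → V × V → V
along horizontal = proj₁
along vertical   = proj₂
across horizontal = proj₂
across vertical   = proj₁

embed-injective : ∀ σ {x x′ w w′ : V} → embed σ x w ≡ embed σ x′ w′ → x ≡ x′ × w ≡ w′
embed-injective horizontal refl = refl , refl
embed-injective vertical   refl = refl , refl

embed-along-across : ∀ σ (v : V × V) → embed σ (along σ v) (across σ v) ≡ v
embed-along-across horizontal v = refl
embed-along-across vertical   v = refl

embed-adj : {G : Graph V} (σ : Direction) {x x′ w : V} →
            Adj G x x′ → Adj (G □ G) (embed σ x w) (embed σ x′ w)
embed-adj horizontal e = inj₂ (refl , e)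
embed-adj vertical   e = inj₁ (refl , e)

□-edge : {G : Graph V} {u v : V × V} → Adj (G □ G) u v →
         ∃ λ σ → across σ u ≡ across σ v × Adj G (along σ u) (along σ v)
□-edge (inj₁ (same , e)) = vertical , same , e
□-edge (inj₂ (same , e)) = horizontal , same , e

both-levels : {u v : V × V} → across horizontal u ≡ across horizontal v →
              across vertical u ≡ across vertical v → u ≡ v
both-levels same₂ same₁ = cong₂ _,_ same₁ same₂

layer : {G : Graph V} → Direction → Cycle G ℓ → V → Cycle (G □ G) ℓ
vert  (layer σ c w) p = embed σ (vert c p) w
len≥3 (layer σ c w) = len≥3 c
inj   (layer σ c w) p q eq = inj c p q (proj₁ (embed-injective σ eq))
adj   (layer {G = G} σ c w) p = embed-adj {G = G} σ (adj c p)

layer-vert : {G : Graph V} (σ : Direction) (c : Cycle G ℓ) {p : Fin ℓ} {v : V × V} →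
             vert c p ≡ along σ v → vert (layer σ c (across σ v)) p ≡ v
layer-vert σ c {v = v} eq =
  trans (cong (λ x → embed σ x (across σ v)) eq) (embed-along-across σ v)

layer-edge : {G : Graph V} (σ : Direction) (c : Cycle G ℓ) (w : V) {u v : V × V} →
             HasEdge (layer σ c w) u v →
             across σ u ≡ w × across σ v ≡ w × HasEdge c (along σ u) (along σ v)
layer-edge horizontal c w (p , inj₁ (refl , refl)) = refl , refl , p , inj₁ (refl , refl)
layer-edge horizontal c w (p , inj₂ (refl , refl)) = refl , refl , p , inj₂ (refl , refl)
layer-edge vertical   c w (p , inj₁ (refl , refl)) = refl , refl , p , inj₁ (refl , refl)
layer-edge vertical   c w (p , inj₂ (refl , refl)) = refl , refl , p , inj₂ (refl , refl)

layer-edge⁻ : {G : Graph V} (σ : Direction) (c : Cycle G ℓ) (w : V) {x x′ : V} →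
              HasEdge c x x′ → HasEdge (layer σ c w) (embed σ x w) (embed σ x′ w)
layer-edge⁻ σ c w (p , inj₁ (e , e′)) = p , inj₁ (cong (λ z → embed σ z w) e , cong (λ z → embed σ z w) e′)
layer-edge⁻ σ c w (p , inj₂ (e , e′)) = p , inj₂ (cong (λ z → embed σ z w) e , cong (λ z → embed σ z w) e′)

-- An edge of G □ G lies in one copy of G, where it is
-- covered by exactly one cycle; two layers of different directions cannot
-- share an edge, as such an edge would be a loop.

layers : {G : Graph V} → (I → Cycle G ℓ) → Direction × I × V → Cycle (G □ G) ℓ
layers C (σ , i , w) = layer σ (C i) w

layers-decompose : {G : Graph V} {C : I → Cycle G ℓ} → IsDecomposition G C →
                   IsDecomposition (G □ G) (layers C)
layers-decompose {G = G} {C = C} (cover , unique) = cover′ , unique′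
  where
  cover′ : ∀ u v → Adj (G □ G) u v → ∃ λ j → HasEdge (layers C j) u v
  cover′ u v uv with □-edge {G = G} uv
  ... | σ , same , e with cover _ _ e
  ...   | i , h = (σ , i , across σ u) ,
    subst₂ (HasEdge (layer σ (C i) (across σ u)))
      (embed-along-across σ u)
      (trans (cong (embed σ (along σ v)) same) (embed-along-across σ v))
      (layer-edge⁻ σ (C i) (across σ u) h)

  same-direction : ∀ σ i i′ w w′ {u v} → HasEdge (layer σ (C i) w) u v →
                   HasEdge (layer σ (C i′) w′) u v → (σ , i , w) ≡ (σ , i′ , w′)
  same-direction σ i i′ w w′ h h′ with layer-edge σ (C i) w h | layer-edge σ (C i′) w′ h′
  ... | refl , _ , g | refl , _ , g′ with unique _ _ _ _ g g′
  ...   | refl = refl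

  cross : ∀ i i′ w w′ {u v} → HasEdge (layer horizontal (C i) w) u v →
          ¬ HasEdge (layer vertical (C i′) w′) u v
  cross i i′ w w′ h h′ with layer-edge horizontal (C i) w h | layer-edge vertical (C i′) w′ h′
  ... | l , l′ , g | k , k′ , _ =
    no-loop (C i) (subst (λ z → HasEdge (C i) _ (along horizontal z))
                         (sym (both-levels (trans l (sym l′)) (trans k (sym k′)))) g)

  unique′ : ∀ u v j j′ → HasEdge (layers C j) u v → HasEdge (layers C j′) u v → j ≡ j′
  unique′ u v (horizontal , i , w) (horizontal , i′ , w′) h h′ = same-direction horizontal i i′ w w′ h h′
  unique′ u v (vertical   , i , w) (vertical   , i′ , w′) h h′ = same-direction vertical i i′ w w′ h h′
  unique′ u v (horizontal , i , w) (vertical   , i′ , w′) h h′ = ⊥-elim (cross i i′ w w′ h h′)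
  unique′ u v (vertical   , i , w) (horizontal , i′ , w′) h h′ = ⊥-elim (cross i′ i w′ w h′ h)

Direction×↔⊎ : (Direction × A) ↔ (A ⊎ A)
Direction×↔⊎ = mk↔ₛ′ to from to-from from-to
  where
  to : Direction × _ → _ ⊎ _
  to (horizontal , x) = inj₁ x
  to (vertical   , x) = inj₂ x
  from : _ ⊎ _ → Direction × _
  from (inj₁ x) = horizontal , x
  from (inj₂ x) = vertical , x
  to-from : ∀ y → to (from y) ≡ y
  to-from (inj₁ x) = refl
  to-from (inj₂ x) = refl
  from-to : ∀ x → from (to x) ≡ x
  from-to (horizontal , x) = refl
  from-to (vertical   , x) = refl

directions : {m : ℕ} → Fin (m + m) ↔ (Direction × Fin m)
directions = ↔-trans +↔⊎ (↔-sym Direction×↔⊎)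

factors-positive : ∀ k b → 1 ≤ k * b → 1 ≤ k × 1 ≤ b
factors-positive k b kb≥1 =
  >-nonZero⁻¹ k {{m*n≢0⇒m≢0 k {{>-nonZero kb≥1}}}} ,
  >-nonZero⁻¹ b {{m*n≢0⇒n≢0 k {{>-nonZero kb≥1}}}}

module Layers {V : Set} {G : Graph V} {ℓ a b : ℕ} (D : DRSplittable G ℓ a b) where
  open DRSplittable D

  cycleAt : Direction × Fin m → Fin k → Fin b × V → Cycle (G □ G) ℓ
  cycleAt (σ , i) s (t , w) = layer σ (C i s t) w

  repAt : Direction × Fin m → Fin k → Fin b × V → Subset ℓ
  repAt (_ , i) s (t , _) = S i s t

  some-vertex : V
  some-vertex = vert c (fromℕ< (≤-trans (s≤s z≤n) (len≥3 c)))
    where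
    kb≥1 : 1 ≤ k × 1 ≤ b
    kb≥1 = factors-positive k b (subst (1 ≤_) a≡kb a≥1)
    c : Cycle G ℓ
    c = C (fromℕ< m≥1) (fromℕ< (proj₁ kb≥1)) (fromℕ< (proj₂ kb≥1))

  allLayers : (Direction × Fin m) × Fin k × (Fin b × V) → Cycle (G □ G) ℓ
  allLayers (x , s , u) = cycleAt x s u

  decompose : IsDecomposition (G □ G) allLayers
  decompose = reindex {C = layers C′} shuffle (layers-decompose {C = C′} decomp)
    where
    C′ : Fin m × Fin k × Fin b → Cycle G ℓ
    C′ (i , s , t) = C i s t
    shuffle : ((Direction × Fin m) × Fin k × (Fin b × V)) ↔ (Direction × (Fin m × Fin k × Fin b) × V)
    shuffle = mk↔ₛ′ (λ { ((σ , i) , s , (t , w)) → σ , (i , s , t) , w })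
                    (λ { (σ , (i , s , t) , w) → (σ , i) , s , (t , w) })
                    (λ _ → refl) (λ _ → refl)

  -- within a class, representing vertices of distinct layers are distinct:
  -- layers at different levels are disjoint, and at the same level this is
  -- the disjointness of the representing sets in G
  rep-disjoint : ∀ x s u s′ u′ → (s , u) ≢ (s′ , u′) → ∀ p p′ →
                 p ∈ repAt x s u → p′ ∈ repAt x s′ u′ →
                 vert (cycleAt x s u) p ≢ vert (cycleAt x s′ u′) p′
  rep-disjoint (σ , i) s (t , w) s′ (t′ , w′) ne p p′ r r′ eq with embed-injective σ eq
  ... | same , refl = repDisj i s t s′ t′ (λ { refl → ne refl }) p p′ r r′ same

  rep-cover : ∀ x v → ∃ λ s → ∃ λ u → ∃ λ p → p ∈ repAt x s u × vert (cycleAt x s u) p ≡ v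
  rep-cover (σ , i) v with repCover i (along σ v)
  ... | s , t , p , r , eq = s , (t , across σ v) , p , r , layer-vert σ (C i s t) eq

  block-disjoint : ∀ x s u u′ → u ≢ u′ → ∀ p p′ → vert (cycleAt x s u) p ≢ vert (cycleAt x s u′) p′
  block-disjoint (σ , i) s (t , w) (t′ , w′) ne p p′ eq with embed-injective σ eq
  ... | same , refl = blockDisj i s t t′ (λ { refl → ne refl }) p p′ same

  block-cover : ∀ x s v → ∃ λ u → OnCycle (cycleAt x s u) v
  block-cover (σ , i) s v with blockCover i s (along σ v)
  ... | t , p , eq = (t , across σ v) , p , layer-vert σ (C i s t) eq

proposition11 : (n ℓ a b : ℕ) (G : Graph (Fin n)) →
    DRSplittable G ℓ a b → DRSplittable (G □ G) ℓ (a * n) (b * n)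
proposition11 n ℓ a b G D = record
  { m = m + m
  ; k = k
  ; a≥1 = *-mono-≤ a≥1 (≤-<-trans z≤n (toℕ<n some-vertex))
  ; m≥1 = ≤-trans m≥1 (m≤m+n m m)
  ; a≡kb = trans (cong (_* n) a≡kb) (*-assoc k b n)
  ; C = λ i s t → cycleAt (class i) s (copy t)
  ; S = λ i s t → repAt (class i) s (copy t)
  ; decomp = reindex {C = allLayers} (directions ×-↔ ↔-refl ×-↔ *↔×) decompose
  ; sizeEq = λ i s t s′ t′ → sizeEq (proj₂ (class i)) s _ s′ _
  ; size≥2 = λ i s t → size≥2 (proj₂ (class i)) s _
  ; repDisj = λ i s t s′ t′ ne → rep-disjoint (class i) s _ s′ _ (ne ∘ to-injective (↔-refl ×-↔ *↔×))
  ; repCover = λ i v → let s , r = rep-cover (class i) v in s , witness-along *↔× r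
  ; blockDisj = λ i s t t′ ne → block-disjoint (class i) s _ _ (ne ∘ to-injective *↔×)
  ; blockCover = λ i s v → witness-along *↔× (block-cover (class i) s v)
  ; dr = λ i s t → dr (proj₂ (class i)) s _
  }
  where
  open DRSplittable D
  open Layers D
  class : Fin (m + m) → Direction × Fin m
  class = Inverse.to directions
  copy : Fin (b * n) → Fin b × Fin n
  copy = Inverse.to *↔×
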